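{- Let $n\ge 1$. (a) For every symmetric Boolean function $f:\{0,1\}^n\to\{0,1\}$ (i.e. $f(a)$ depends only on the weight $|a|=\sum_i a_i$ of $a$) it holds that $NN(f)\le n+1$. (b) For the parity function $x_1\oplus x_2\oplus\cdots\oplus x_n$ on $n$ variables, $BNN(x_1\oplus\cdots\oplus x_n)=2^n$.
   Context: $d$ denotes Euclidean distance in $\mathbb R^n$. A nearest neighbor (NN) representation of a Boolean function $f:\{0,1\}^n\to\{0,1\}$ is a pair of disjoint sets $P,N\subseteq\mathbb R^n$ (positive and negative prototypes) such that for every $a\in\{0,1\}^n$: if $f(a)=1$ there is $b\in P$ with $d(a,b)<d(a,c)$ for all $c\in N$, and if $f(a)=0$ there is $b\in N$ with $d(a,b)<d(a,c)$ for all $c\in P$. Its size is $|P\cup N|$. $NN(f)$ is the minimum size of an NN representation of $f$. An NN representation is Boolean if $P\cup N\subseteq\{0,1\}^n$, and $BNN(f)$ is the minimum size of a Boolean NN representation of $f$. -}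

module Defs where

open import Data.Nat using (ℕ; suc; _≤_)
open import Data.Bool using (Bool; true; false; _xor_)
open import Data.Rational using (ℚ; 0ℚ; 1ℚ; _+_; _-_; _*_; _<_)
open import Data.Vec using (Vec; map; zipWith; foldr′; count)
open import Data.List using (List; length; _++_)
open import Data.List.Membership.Propositional using (_∈_)
open import Data.List.Relation.Unary.Unique.Propositional using (Unique)
open import Data.Product using (Σ; _×_; ∃-syntax)
open import Data.Empty using (⊥)
open import Relation.Binary.PropositionalEquality using (_≡_)
open import Relation.Nullary using (¬_)
open import Function using (id)

BoolFun : ℕ → Set
BoolFun n = Vec Bool n → Bool

bit : Bool → ℚ
bit true  = 1ℚ
bit false = 0ℚ

embed : ∀ {n} → Vec Bool n → Vec ℚ n
embed = map bit

-- Squared Euclidean distance. Comparing d(a,b) < d(a,c) is equivalent to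
-- comparing squared distances since sqrt is strictly monotone on [0,∞).
sqdist : ∀ {n} → Vec ℚ n → Vec ℚ n → ℚ
sqdist x y = foldr′ _+_ 0ℚ (zipWith (λ u v → (u - v) * (u - v)) x y)

weight : ∀ {n} → Vec Bool n → ℕ
weight a = count (λ b → Data.Bool._≟_ b true) a
  where import Data.Bool

Symmetric : ∀ {n} → BoolFun n → Set
Symmetric {n} f = ∀ (a b : Vec Bool n) → weight a ≡ weight b → f a ≡ f b

parity : ∀ {n} → BoolFun n
parity = foldr′ _xor_ false

IsNNRep : ∀ {n} → BoolFun n → List (Vec ℚ n) → List (Vec ℚ n) → Set
IsNNRep {n} f P N =
  (∀ x → x ∈ P → x ∈ N → ⊥) ×
  (∀ (a : Vec Bool n) →
     (f a ≡ true → ∃[ b ] (b ∈ P × (∀ c → c ∈ N → sqdist (embed a) b < sqdist (embed a) c))) ×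
     (f a ≡ false → ∃[ b ] (b ∈ N × (∀ c → c ∈ P → sqdist (embed a) b < sqdist (embed a) c))))

IsBNNRep : ∀ {n} → BoolFun n → List (Vec Bool n) → List (Vec Bool n) → Set
IsBNNRep f P N =
  (∀ x → x ∈ P → x ∈ N → ⊥) × IsNNRep f (Data.List.map embed P) (Data.List.map embed N)
  where import Data.List

-- NN(f) ≤ k : some NN representation (P, N) with |P ∪ N| ≤ k.
-- Sets are given as duplicate-free lists (Unique (P ++ N)), so |P ∪ N| = length (P ++ N).
NN≤ : ∀ {n} → BoolFun n → ℕ → Set
NN≤ {n} f k = ∃[ P ] ∃[ N ] (IsNNRep {n} f P N × Unique (P ++ N) × length (P ++ N) ≤ k)

BNN≡ : ∀ {n} → BoolFun n → ℕ → Set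
BNN≡ {n} f m =
  (∃[ P ] ∃[ N ] (IsBNNRep {n} f P N × Unique (P ++ N) × length (P ++ N) ≡ m)) ×
  (∀ P N → IsBNNRep {n} f P N → Unique (P ++ N) → m ≤ length (P ++ N))

-- (a) For a symmetric f on n ≥ 1 variables we place one prototype on the
--     diagonal at t_k = (k/n, …, k/n) for every weight k = 0 … n and label it
--     f(1^k 0^(n-k)).  For a vertex a of weight w the squared distance to the
--     diagonal point (t, …, t) is w - 2wt + nt², and with t = k/n this equals
--     its value at k = w plus (k - w)²/n, so t_w is the unique nearest
--     prototype and it carries the label f(a).
-- (b) Upper bound: every vertex is a prototype labelled by its parity, so each
--     vertex is its own nearest prototype.  Lower bound: in a Boolean
--     representation distances are Hamming distances.  If a vertex a were not
--     a prototype, take its nearest prototype b of the right class and step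
--     from a one coordinate towards b; the new vertex a' has the other parity,
--     so some prototype c of the other class is strictly closer to a' than b,
--     and then c is at least as close to a as b — a contradiction.  Hence all
--     2^n vertices are prototypes.
module Submission where

open import Defs
open import Data.Nat as Nat using (ℕ; zero; suc; z≤n; s≤s; _^_)
import Data.Nat.Properties as ℕP
open import Data.Bool as B using (Bool; true; false; not; _xor_)
import Data.Bool.Properties as BP
open import Data.Rational as Rat using (ℚ; 0ℚ; 1ℚ; 1/_; positive; negative; nonNegative)
import Data.Rational.Properties as ℚP
open import Data.Vec using (Vec; []; _∷_; replicate)
import Data.Vec.Properties as VP
open import Data.List using (List; []; _∷_; map; filter; upTo; length; _++_)
import Data.List.Properties as LP
open import Data.List.Relation.Unary.Any using (here; there; _─_)
import Data.List.Relation.Unary.All as All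
open import Data.List.Relation.Unary.Unique.Propositional using (Unique; []; _∷_)
import Data.List.Relation.Unary.Unique.Propositional.Properties as Unique
open import Data.List.Membership.Propositional using (_∈_; _∉_)
open import Data.List.Membership.Propositional.Properties
open import Data.Product using (Σ; _×_; _,_; ∃-syntax; proj₁; proj₂)
open import Data.Empty using (⊥; ⊥-elim)
open import Relation.Binary using (tri<; tri≈; tri>)
open import Relation.Binary.PropositionalEquality
open import Relation.Nullary using (¬_; yes; no)
open import Relation.Nullary.Decidable using (decidable-stable)
open import Function using (_∘_)
open import Algebra.Properties.CommutativeSemigroup ℕP.+-commutativeSemigroup using (interchange)

module Rationals where

  open Rat using (_+_; _-_; _*_; _<_; _≤_)
  open import Data.Rational.Solver using (module +-*-Solver)
  open +-*-Solver

  -- The embedding ℕ → ℚ, by repeated addition of 1 so that it matches the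
  -- way sqdist accumulates one coordinate at a time.
  ι : ℕ → ℚ
  ι zero    = 0ℚ
  ι (suc k) = 1ℚ + ι k

  x<1+x : ∀ x → x < 1ℚ + x
  x<1+x x = subst (_< 1ℚ + x) (ℚP.+-identityˡ x) (ℚP.+-monoˡ-< x (ℚP.positive⁻¹ 1ℚ))

  ι-nonneg : ∀ k → 0ℚ ≤ ι k
  ι-nonneg zero    = ℚP.≤-refl
  ι-nonneg (suc k) = ℚP.+-mono-≤ (ℚP.nonNegative⁻¹ 1ℚ) (ι-nonneg k)

  ι-mono-≤ : ∀ {m n} → m Nat.≤ n → ι m ≤ ι n
  ι-mono-≤ {n = n} z≤n = ι-nonneg n
  ι-mono-≤ (s≤s m≤n)   = ℚP.+-monoʳ-≤ 1ℚ (ι-mono-≤ m≤n)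

  ι-mono-< : ∀ {m n} → m Nat.< n → ι m < ι n
  ι-mono-< {m} (s≤s m≤n) = ℚP.<-≤-trans (x<1+x (ι m)) (ℚP.+-monoʳ-≤ 1ℚ (ι-mono-≤ m≤n))

  ι-cancel-< : ∀ {m n} → ι m < ι n → m Nat.< n
  ι-cancel-< {m} {n} ιm<ιn with m Nat.<? n
  ... | yes m<n = m<n
  ... | no  m≮n = ⊥-elim (ℚP.<-irrefl refl (ℚP.<-≤-trans ιm<ιn (ι-mono-≤ (ℕP.≮⇒≥ m≮n))))

  strictMono⇒injective : (h : ℕ → ℚ) → (∀ {m n} → m Nat.< n → h m < h n) →
                         ∀ {m n} → h m ≡ h n → m ≡ n
  strictMono⇒injective h mono {m} {n} hm≡hn with ℕP.<-cmp m n
  ... | tri< m<n _ _ = ⊥-elim (ℚP.<-irrefl hm≡hn (mono m<n))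
  ... | tri≈ _ m≡n _ = m≡n
  ... | tri> _ _ n<m = ⊥-elim (ℚP.<-irrefl (sym hm≡hn) (mono n<m))

  square-pos : ∀ x → x ≢ 0ℚ → 0ℚ < x * x
  square-pos x x≢0 with ℚP.<-cmp x 0ℚ
  ... | tri< x<0 _ _ = subst (_< x * x) (ℚP.*-zeroˡ x) (ℚP.*-monoˡ-<-neg x {{negative x<0}} x<0)
  ... | tri≈ _ x≡0 _ = ⊥-elim (x≢0 x≡0)
  ... | tri> _ _ 0<x = subst (_< x * x) (ℚP.*-zeroˡ x) (ℚP.*-monoˡ-<-pos x {{positive 0<x}} 0<x)

  ι-difference≢0 : ∀ {k w} → k ≢ w → ι k - ι w ≢ 0ℚ
  ι-difference≢0 {k} {w} k≢w d≡0 = k≢w (strictMono⇒injective ι ι-mono-< (begin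
      ι k                 ≡⟨ solve 2 (λ K W → K := (K :- W) :+ W) refl (ι k) (ι w) ⟩
      (ι k - ι w) + ι w   ≡⟨ cong (_+ ι w) d≡0 ⟩
      0ℚ + ι w            ≡⟨ ℚP.+-identityˡ (ι w) ⟩
      ι w                 ∎))
    where open ≡-Reasoning

  reciprocal : ∀ m → Σ ℚ λ u → (ι (suc m) * u ≡ 1ℚ) × (0ℚ < u)
  reciprocal m = (1/ n) {{n≢0}} , ℚP.*-inverseʳ n {{n≢0}} , ℚP.positive⁻¹ _ {{ℚP.1/pos⇒pos n {{n>0}}}}
    where
    n : ℚ
    n = ι (suc m)
    n>0 : Rat.Positive n
    n>0 = ℚP.pos+nonNeg⇒pos 1ℚ (ι m) {{nonNegative (ι-nonneg m)}}
    n≢0 : Rat.NonZero n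
    n≢0 = ℚP.pos⇒nonZero n {{n>0}}

  -- Squared distance from a vertex of weight W in {0,1}^N to the diagonal
  -- point (t, …, t).
  diagonalSqDist : ℚ → ℚ → ℚ → ℚ
  diagonalSqDist W N t = W - (W + W) * t + N * (t * t)

  sqdist-diagonal : ∀ {n} (a : Vec Bool n) t →
                    sqdist (embed a) (replicate n t) ≡ diagonalSqDist (ι (weight a)) (ι n) t
  sqdist-diagonal [] t =
    solve 1 (λ t → con 0ℚ := con 0ℚ :- (con 0ℚ :+ con 0ℚ) :* t :+ con 0ℚ :* (t :* t)) refl t
  sqdist-diagonal {suc n} (true ∷ a) t = trans (cong ((1ℚ - t) * (1ℚ - t) +_) (sqdist-diagonal a t))
    (solve 3 (λ W N t → (con 1ℚ :- t) :* (con 1ℚ :- t) :+ (W :- (W :+ W) :* t :+ N :* (t :* t))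
       := (con 1ℚ :+ W) :- ((con 1ℚ :+ W) :+ (con 1ℚ :+ W)) :* t :+ (con 1ℚ :+ N) :* (t :* t))
       refl (ι (weight a)) (ι n) t)
  sqdist-diagonal {suc n} (false ∷ a) t = trans (cong ((0ℚ - t) * (0ℚ - t) +_) (sqdist-diagonal a t))
    (solve 3 (λ W N t → (con 0ℚ :- t) :* (con 0ℚ :- t) :+ (W :- (W :+ W) :* t :+ N :* (t :* t))
       := W :- (W :+ W) :* t :+ (con 1ℚ :+ N) :* (t :* t))
       refl (ι (weight a)) (ι n) t)

  diagonal-gap : ∀ W N K u → N * u ≡ 1ℚ →
                 diagonalSqDist W N (K * u) ≡ diagonalSqDist W N (W * u) + u * ((K - W) * (K - W))
  diagonal-gap W N K u Nu≡1 = begin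
      diagonalSqDist W N (K * u)
        ≡⟨ solve 4 (λ W N K u → W :- (W :+ W) :* (K :* u) :+ N :* ((K :* u) :* (K :* u))
                             := W :- (W :+ W) :* (K :* u) :+ K :* K :* u :* (N :* u)) refl W N K u ⟩
      W - (W + W) * (K * u) + K * K * u * (N * u)
        ≡⟨ cong (λ e → W - (W + W) * (K * u) + K * K * u * e) Nu≡1 ⟩
      W - (W + W) * (K * u) + K * K * u * 1ℚ
        ≡⟨ solve 3 (λ W K u → W :- (W :+ W) :* (K :* u) :+ K :* K :* u :* con 1ℚ
                           := (W :- (W :+ W) :* (W :* u) :+ W :* W :* u :* con 1ℚ) :+ u :* ((K :- W) :* (K :- W)))
                   refl W K u ⟩
      (W - (W + W) * (W * u) + W * W * u * 1ℚ) + u * ((K - W) * (K - W))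
        ≡⟨ cong (λ e → (W - (W + W) * (W * u) + W * W * u * e) + u * ((K - W) * (K - W))) (sym Nu≡1) ⟩
      (W - (W + W) * (W * u) + W * W * u * (N * u)) + u * ((K - W) * (K - W))
        ≡⟨ solve 4 (λ W N u E → (W :- (W :+ W) :* (W :* u) :+ W :* W :* u :* (N :* u)) :+ E
                             := (W :- (W :+ W) :* (W :* u) :+ N :* ((W :* u) :* (W :* u))) :+ E)
                   refl W N u (u * ((K - W) * (K - W))) ⟩
      diagonalSqDist W N (W * u) + u * ((K - W) * (K - W)) ∎
    where open ≡-Reasoning

  diagonal-strict : ∀ n u {w k} → ι n * u ≡ 1ℚ → 0ℚ < u → k ≢ w →
                    diagonalSqDist (ι w) (ι n) (ι w * u) < diagonalSqDist (ι w) (ι n) (ι k * u)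
  diagonal-strict n u {w} {k} nu≡1 0<u k≢w =
    subst (D (ι w * u) <_) (sym (diagonal-gap (ι w) (ι n) (ι k) u nu≡1))
      (subst (_< D (ι w * u) + excess) (ℚP.+-identityʳ _) (ℚP.+-monoʳ-< (D (ι w * u)) 0<excess))
    where
    D : ℚ → ℚ
    D = diagonalSqDist (ι w) (ι n)
    excess : ℚ
    excess = u * ((ι k - ι w) * (ι k - ι w))
    0<excess : 0ℚ < excess
    0<excess = ℚP.positive⁻¹ excess
      {{ℚP.pos*pos⇒pos u {{positive 0<u}} _ {{positive (square-pos _ (ι-difference≢0 k≢w))}}}}

open Rationals

module Hamming where

  open Nat using (_+_; _≤_)

  hd : Bool → Bool → ℕ
  hd true  true  = 0
  hd false false = 0
  hd true  false = 1
  hd false true  = 1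

  ham : ∀ {n} → Vec Bool n → Vec Bool n → ℕ
  ham []       []       = 0
  ham (x ∷ xs) (y ∷ ys) = hd x y + ham xs ys

  hd-self : ∀ x → hd x x ≡ 0
  hd-self true  = refl
  hd-self false = refl

  hd-not : ∀ x → hd x (not x) ≡ 1
  hd-not true  = refl
  hd-not false = refl

  sqdist-embed : ∀ {n} (a b : Vec Bool n) → sqdist (embed a) (embed b) ≡ ι (ham a b)
  sqdist-embed []          []          = refl
  sqdist-embed (true ∷ a)  (true ∷ b)  = trans (ℚP.+-identityˡ _) (sqdist-embed a b)
  sqdist-embed (false ∷ a) (false ∷ b) = trans (ℚP.+-identityˡ _) (sqdist-embed a b)
  sqdist-embed (true ∷ a)  (false ∷ b) = cong (1ℚ Rat.+_) (sqdist-embed a b)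
  sqdist-embed (false ∷ a) (true ∷ b)  = cong (1ℚ Rat.+_) (sqdist-embed a b)

  ham-self : ∀ {n} (a : Vec Bool n) → ham a a ≡ 0
  ham-self []      = refl
  ham-self (x ∷ a) = trans (cong (_+ ham a a) (hd-self x)) (ham-self a)

  ham≡0⇒≡ : ∀ {n} (a b : Vec Bool n) → ham a b ≡ 0 → a ≡ b
  ham≡0⇒≡ []          []          _  = refl
  ham≡0⇒≡ (true ∷ a)  (true ∷ b)  h  = cong (true ∷_) (ham≡0⇒≡ a b h)
  ham≡0⇒≡ (false ∷ a) (false ∷ b) h  = cong (false ∷_) (ham≡0⇒≡ a b h)
  ham≡0⇒≡ (true ∷ a)  (false ∷ b) ()
  ham≡0⇒≡ (false ∷ a) (true ∷ b)  ()

  embed-injective : ∀ {n} {a b : Vec Bool n} → embed a ≡ embed b → a ≡ b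
  embed-injective {a = a} {b} ea≡eb = ham≡0⇒≡ a b (strictMono⇒injective ι ι-mono-< (begin
      ι (ham a b)               ≡⟨ sqdist-embed a b ⟨
      sqdist (embed a) (embed b) ≡⟨ cong (sqdist (embed a)) ea≡eb ⟨
      sqdist (embed a) (embed a) ≡⟨ sqdist-embed a a ⟩
      ι (ham a a)               ≡⟨ cong ι (ham-self a) ⟩
      ι 0                       ∎))
    where open ≡-Reasoning

  hd-triangle : ∀ x y z → hd x z ≤ hd x y + hd y z
  hd-triangle true  true  z     = ℕP.≤-refl
  hd-triangle false false z     = ℕP.≤-refl
  hd-triangle true  false true  = z≤n
  hd-triangle true  false false = s≤s z≤n
  hd-triangle false true  true  = s≤s z≤n
  hd-triangle false true  false = z≤n

  ham-triangle : ∀ {n} (a b c : Vec Bool n) → ham a c ≤ ham a b + ham b c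
  ham-triangle []      []      []      = z≤n
  ham-triangle (x ∷ a) (y ∷ b) (z ∷ c) = begin
      hd x z + ham a c                        ≤⟨ ℕP.+-mono-≤ (hd-triangle x y z) (ham-triangle a b c) ⟩
      (hd x y + hd y z) + (ham a b + ham b c) ≡⟨ interchange (hd x y) (hd y z) (ham a b) (ham b c) ⟩
      (hd x y + ham a b) + (hd y z + ham b c) ∎
    where
    open ℕP.≤-Reasoning

  step-toward : ∀ {n} (a b : Vec Bool n) → a ≢ b →
    ∃[ a′ ] (ham a a′ ≡ 1 × suc (ham a′ b) ≡ ham a b × parity a′ ≡ not (parity a))
  step-toward []       []       []≢[] = ⊥-elim ([]≢[] refl)
  step-toward (x ∷ xs) (y ∷ ys) a≢b with x B.≟ y
  ... | no x≢y rewrite BP.¬-not (λ y≡x → x≢y (sym y≡x)) = not x ∷ xs , moved , closer , flipped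
    where
    moved : hd x (not x) + ham xs xs ≡ 1
    moved rewrite hd-not x | ham-self xs = refl
    closer : suc (hd (not x) (not x) + ham xs ys) ≡ hd x (not x) + ham xs ys
    closer rewrite hd-self (not x) | hd-not x = refl
    flipped : not x xor parity xs ≡ not (x xor parity xs)
    flipped = sym (BP.not-distribˡ-xor x (parity xs))
  ... | yes refl with step-toward xs ys (λ xs≡ys → a≢b (cong (x ∷_) xs≡ys))
  ...   | a′ , moved , closer , flipped = x ∷ a′ , moved′ , closer′ , flipped′
    where
    moved′ : hd x x + ham xs a′ ≡ 1
    moved′ rewrite hd-self x = moved
    closer′ : suc (hd x x + ham a′ ys) ≡ hd x x + ham xs ys
    closer′ rewrite hd-self x = closer
    flipped′ : x xor parity a′ ≡ not (x xor parity xs)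
    flipped′ rewrite flipped = sym (BP.not-distribʳ-xor x (parity xs))

open Hamming

module Labelled {I : Set} (label : I → Bool) where

  withLabel : Bool → List I → List I
  withLabel β = filter (λ i → label i B.≟ β)

  withLabel⁺ : ∀ β is {i} → i ∈ is → label i ≡ β → i ∈ withLabel β is
  withLabel⁺ β is = ∈-filter⁺ (λ i → label i B.≟ β)

  withLabel⁻ : ∀ β is {i} → i ∈ withLabel β is → i ∈ is × label i ≡ β
  withLabel⁻ β is = ∈-filter⁻ (λ i → label i B.≟ β) {xs = is}

  classes-disjoint : ∀ is {i} → i ∈ withLabel true is → i ∈ withLabel false is → ⊥
  classes-disjoint is i∈P i∈N with trans (sym (proj₂ (withLabel⁻ true is i∈P))) (proj₂ (withLabel⁻ false is i∈N))
  ... | ()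

  classes-length : ∀ is → length (withLabel true is) Nat.+ length (withLabel false is) ≡ length is
  classes-length []       = refl
  classes-length (i ∷ is) with label i
  ... | true  = cong suc (classes-length is)
  ... | false = trans (ℕP.+-suc _ _) (cong suc (classes-length is))

  classes-unique : ∀ is → Unique is → Unique (withLabel true is ++ withLabel false is)
  classes-unique is uniq = Unique.++⁺ (Unique.filter⁺ _ uniq) (Unique.filter⁺ _ uniq)
                                   (λ (i∈P , i∈N) → classes-disjoint is i∈P i∈N)

  module Placed {n} (proto : I → Vec ℚ n) (proto-injective : ∀ {i j} → proto i ≡ proto j → i ≡ j)
                (is : List I) where

    Prototypes : Bool → List (Vec ℚ n)
    Prototypes β = map proto (withLabel β is)

    prototypes-unique : Unique is → Unique (Prototypes true ++ Prototypes false)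
    prototypes-unique uniq = subst Unique (LP.map-++ proto (withLabel true is) (withLabel false is))
                               (Unique.map⁺ proto-injective (classes-unique is uniq))

    prototypes-length : length (Prototypes true ++ Prototypes false) ≡ length is
    prototypes-length = begin
      length (Prototypes true ++ Prototypes false)
        ≡⟨ LP.length-++ (Prototypes true) ⟩
      length (Prototypes true) Nat.+ length (Prototypes false)
        ≡⟨ cong₂ Nat._+_ (LP.length-map proto (withLabel true is)) (LP.length-map proto (withLabel false is)) ⟩
      length (withLabel true is) Nat.+ length (withLabel false is)
        ≡⟨ classes-length is ⟩
      length is ∎
      where open ≡-Reasoning

    labelled-rep : (f : BoolFun n) (centre : Vec Bool n → I) →
      (∀ a → centre a ∈ is) → (∀ a → label (centre a) ≡ f a) →
      (∀ a i → i ∈ is → i ≢ centre a → sqdist (embed a) (proto (centre a)) Rat.< sqdist (embed a) (proto i)) →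
      IsNNRep f (Prototypes true) (Prototypes false)
    labelled-rep f centre centre∈ centre-label nearest = disjoint , λ a → winner a true , winner a false
      where
      disjoint : ∀ x → x ∈ Prototypes true → x ∈ Prototypes false → ⊥
      disjoint x x∈P x∈N with ∈-map⁻ proto x∈P | ∈-map⁻ proto x∈N
      ... | i , i∈P , refl | j , j∈N , pi≡pj = classes-disjoint is i∈P (subst (_∈ _) (sym (proto-injective pi≡pj)) j∈N)

      winner : ∀ a β → f a ≡ β → ∃[ b ] (b ∈ Prototypes β ×
                 (∀ c → c ∈ Prototypes (not β) → sqdist (embed a) b Rat.< sqdist (embed a) c))
      winner a β fa≡β = proto (centre a) , ∈-map⁺ proto (withLabel⁺ β is (centre∈ a) label≡β) , beats
        where
        label≡β : label (centre a) ≡ β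
        label≡β = trans (centre-label a) fa≡β
        beats : ∀ c → c ∈ Prototypes (not β) → sqdist (embed a) (proto (centre a)) Rat.< sqdist (embed a) c
        beats c c∈ with ∈-map⁻ proto c∈
        ... | i , i∈ , refl = nearest a i (proj₁ (withLabel⁻ (not β) is i∈))
          (λ i≡centre → BP.not-¬ label≡β (trans (cong label (sym i≡centre)) (proj₂ (withLabel⁻ (not β) is i∈))))

module Counting {A : Set} where

  open import Data.List.Relation.Unary.Any using (index)

  ∈-─ : ∀ {x z : A} {ys} (x∈ys : x ∈ ys) → z ∈ ys → z ≢ x → z ∈ (ys ─ x∈ys)
  ∈-─ (here refl) (here refl) z≢x = ⊥-elim (z≢x refl)
  ∈-─ (here _)    (there z∈)  _   = z∈
  ∈-─ (there _)   (here refl) _   = here refl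
  ∈-─ (there x∈)  (there z∈)  z≢x = there (∈-─ x∈ z∈ z≢x)

  unique-⊆-length : ∀ {xs ys : List A} → Unique xs → (∀ {z} → z ∈ xs → z ∈ ys) →
                    length xs Nat.≤ length ys
  unique-⊆-length {[]}              _                xs⊆ys = z≤n
  unique-⊆-length {x ∷ xs} {ys} (x∉xs ∷ uniq) xs⊆ys = begin
      suc (length xs)          ≤⟨ s≤s (unique-⊆-length uniq rest⊆) ⟩
      suc (length (ys ─ x∈ys)) ≡⟨ LP.length-removeAt′ ys (index x∈ys) ⟨
      length ys                ∎
    where
    open ℕP.≤-Reasoning
    x∈ys : x ∈ ys
    x∈ys = xs⊆ys (here refl)
    rest⊆ : ∀ {z} → z ∈ xs → z ∈ (ys ─ x∈ys)
    rest⊆ z∈xs = ∈-─ x∈ys (xs⊆ys (there z∈xs)) (λ z≡x → All.lookup x∉xs z∈xs (sym z≡x))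

open Counting

vertices : ∀ n → List (Vec Bool n)
vertices zero    = [] ∷ []
vertices (suc n) = map (true ∷_) (vertices n) ++ map (false ∷_) (vertices n)

vertices-complete : ∀ {n} (a : Vec Bool n) → a ∈ vertices n
vertices-complete []          = here refl
vertices-complete (true ∷ a)  = ∈-++⁺ˡ (∈-map⁺ (true ∷_) (vertices-complete a))
vertices-complete {suc n} (false ∷ a) =
  ∈-++⁺ʳ (map (true ∷_) (vertices n)) (∈-map⁺ (false ∷_) (vertices-complete a))

vertices-unique : ∀ n → Unique (vertices n)
vertices-unique zero    = All.[] ∷ []
vertices-unique (suc n) = Unique.++⁺ (Unique.map⁺ VP.∷-injectiveʳ (vertices-unique n))
                                     (Unique.map⁺ VP.∷-injectiveʳ (vertices-unique n)) heads-differ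
  where
  heads-differ : ∀ {v} → ¬ (v ∈ map (true ∷_) (vertices n) × v ∈ map (false ∷_) (vertices n))
  heads-differ (v∈T , v∈F) with ∈-map⁻ (true ∷_) v∈T | ∈-map⁻ (false ∷_) v∈F
  ... | _ , _ , refl | _ , _ , ()

vertices-length : ∀ n → length (vertices n) ≡ 2 ^ n
vertices-length zero    = refl
vertices-length (suc n) = begin
    length (map (true ∷_) (vertices n) ++ map (false ∷_) (vertices n))
      ≡⟨ LP.length-++ (map (true ∷_) (vertices n)) ⟩
    length (map (true ∷_) (vertices n)) Nat.+ length (map (false ∷_) (vertices n))
      ≡⟨ cong₂ Nat._+_ (LP.length-map _ (vertices n)) (LP.length-map _ (vertices n)) ⟩
    length (vertices n) Nat.+ length (vertices n)
      ≡⟨ cong₂ Nat._+_ (vertices-length n) (trans (vertices-length n) (sym (ℕP.+-identityʳ (2 ^ n)))) ⟩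
    2 ^ suc n ∎
  where open ≡-Reasoning

canonical : (n k : ℕ) → Vec Bool n
canonical zero    k       = []
canonical (suc n) zero    = false ∷ canonical n zero
canonical (suc n) (suc k) = true ∷ canonical n k

weight-canonical : ∀ n k → k Nat.≤ n → weight (canonical n k) ≡ k
weight-canonical zero    zero    z≤n       = refl
weight-canonical (suc n) zero    z≤n       = weight-canonical n zero z≤n
weight-canonical (suc n) (suc k) (s≤s k≤n) = cong suc (weight-canonical n k k≤n)

weight≤length : ∀ {n} (a : Vec Bool n) → weight a Nat.≤ n
weight≤length []          = z≤n
weight≤length (true ∷ a)  = s≤s (weight≤length a)
weight≤length (false ∷ a) = ℕP.m≤n⇒m≤1+n (weight≤length a)

symmetric-canonical : ∀ {n} (f : BoolFun n) → Symmetric f → ∀ a → f (canonical n (weight a)) ≡ f a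
symmetric-canonical {n} f f-sym a =
  f-sym (canonical n (weight a)) a (weight-canonical n (weight a) (weight≤length a))

-- Prototypes on the diagonal at the n+1 grid points k/n, labelled by f on
-- the canonical vertex of weight k; the vertex a is won by the grid point of
-- its own weight.
symmetric-nn : ∀ m (f : BoolFun (suc m)) → Symmetric f → NN≤ f (suc (suc m))
symmetric-nn m f f-sym =
  Prototypes true , Prototypes false ,
  labelled-rep f weight weight∈weights (symmetric-canonical f f-sym) grid-nearest ,
  prototypes-unique (Unique.upTo⁺ (suc n)) ,
  ℕP.≤-reflexive (trans prototypes-length (LP.length-upTo (suc n)))
  where
  n : ℕ
  n = suc m

  u : ℚ
  u = proj₁ (reciprocal m)
  nu≡1 : ι n Rat.* u ≡ 1ℚ
  nu≡1 = proj₁ (proj₂ (reciprocal m))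
  0<u : 0ℚ Rat.< u
  0<u = proj₂ (proj₂ (reciprocal m))

  grid : ℕ → Vec ℚ n
  grid k = replicate n (ι k Rat.* u)

  grid-injective : ∀ {j k} → grid j ≡ grid k → j ≡ k
  grid-injective = strictMono⇒injective (λ k → ι k Rat.* u)
                     (λ j<k → ℚP.*-monoˡ-<-pos u {{positive 0<u}} (ι-mono-< j<k))
                   ∘ VP.∷-injectiveˡ

  weights : List ℕ
  weights = upTo (suc n)
  open Labelled (λ k → f (canonical n k))
  open Placed grid grid-injective weights

  weight∈weights : ∀ a → weight a ∈ weights
  weight∈weights a = ∈-upTo⁺ (s≤s (weight≤length a))

  grid-nearest : ∀ a k → k ∈ weights → k ≢ weight a →
                 sqdist (embed a) (grid (weight a)) Rat.< sqdist (embed a) (grid k)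
  grid-nearest a k _ k≢w = subst₂ Rat._<_ (sym (sqdist-diagonal a _)) (sym (sqdist-diagonal a _))
                             (diagonal-strict n u nu≡1 0<u k≢w)

parity-bnn-upper : ∀ n → ∃[ P ] ∃[ N ] (IsBNNRep (parity {n}) P N × Unique (P ++ N) × length (P ++ N) ≡ 2 ^ n)
parity-bnn-upper n =
  withLabel true (vertices n) , withLabel false (vertices n) ,
  ((λ _ → classes-disjoint (vertices n)) ,
   labelled-rep parity (λ a → a) vertices-complete (λ _ → refl) self-nearest) ,
  classes-unique (vertices n) (vertices-unique n) ,
  trans (LP.length-++ (withLabel true (vertices n))) (trans (classes-length (vertices n)) (vertices-length n))
  where
  open Labelled parity
  open Placed embed embed-injective (vertices n)

  self-nearest : ∀ a c → c ∈ vertices n → c ≢ a → sqdist (embed a) (embed a) Rat.< sqdist (embed a) (embed c)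
  self-nearest a c _ c≢a rewrite sqdist-embed a a | sqdist-embed a c | ham-self a =
    ι-mono-< (ℕP.n≢0⇒n>0 (λ ham≡0 → c≢a (sym (ham≡0⇒≡ a c ham≡0))))

HamCloser : ∀ {n} → Vec Bool n → List (Vec Bool n) → List (Vec Bool n) → Set
HamCloser a X Y = ∃[ b ] (b ∈ X × (∀ c → c ∈ Y → ham a b Nat.< ham a c))

to-hamCloser : ∀ {n} (a : Vec Bool n) X Y →
  ∃[ b ] (b ∈ map embed X × (∀ c → c ∈ map embed Y → sqdist (embed a) b Rat.< sqdist (embed a) c)) →
  HamCloser a X Y
to-hamCloser a X Y (b′ , b′∈ , b′-wins) with ∈-map⁻ embed b′∈
... | b , b∈X , refl = b , b∈X , λ c c∈Y →
  ι-cancel-< (subst₂ Rat._<_ (sqdist-embed a b) (sqdist-embed a c) (b′-wins (embed c) (∈-map⁺ embed c∈Y)))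

-- If a beats Y with an X-prototype while every vertex of the opposite
-- parity beats X with a Y-prototype, then a itself must be an X-prototype:
-- otherwise stepping from a towards its winner b gives a vertex a′ whose
-- Y-winner c satisfies ham a c ≤ 1 + ham a′ c ≤ ham a′ b < ham a b.
vertex-is-prototype : ∀ {n} (a : Vec Bool n) X Y → HamCloser a X Y →
  (∀ a′ → parity a′ ≡ not (parity a) → HamCloser a′ Y X) → a ∈ X
vertex-is-prototype a X Y (b , b∈X , b-wins) opposite-wins = decidable-stable (a ∈? X) absurd
  where
  open import Data.List.Membership.DecPropositional (VP.≡-dec B._≟_) using (_∈?_)
  absurd : a ∉ X → ⊥
  absurd a∉X with step-toward a b (λ a≡b → a∉X (subst (_∈ X) (sym a≡b) b∈X))
  ... | a′ , moved , closer , flipped with opposite-wins a′ flipped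
  ...   | c , c∈Y , c-wins = ℕP.<-irrefl refl (begin-strict
      ham a c                   ≤⟨ ham-triangle a a′ c ⟩
      ham a a′ Nat.+ ham a′ c   ≡⟨ cong (Nat._+ ham a′ c) moved ⟩
      suc (ham a′ c)            ≤⟨ c-wins b b∈X ⟩
      ham a′ b                  <⟨ ℕP.n<1+n (ham a′ b) ⟩
      suc (ham a′ b)            ≡⟨ closer ⟩
      ham a b                   <⟨ b-wins c c∈Y ⟩
      ham a c                   ∎)
    where open ℕP.≤-Reasoning

parity-bnn-lower : ∀ n P N → IsBNNRep (parity {n}) P N → Unique (P ++ N) → 2 ^ n Nat.≤ length (P ++ N)
parity-bnn-lower n P N (_ , _ , nn) _ =
  subst (Nat._≤ length (P ++ N)) (vertices-length n)
    (unique-⊆-length (vertices-unique n) (λ {a} _ → prototype a))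
  where
  prototype : ∀ a → a ∈ P ++ N
  prototype a with parity a in eq
  ... | true  = ∈-++⁺ˡ (vertex-is-prototype a P N (to-hamCloser a P N (proj₁ (nn a) eq))
                  λ a′ flipped → to-hamCloser a′ N P (proj₂ (nn a′) (trans flipped (cong not eq))))
  ... | false = ∈-++⁺ʳ P (vertex-is-prototype a N P (to-hamCloser a N P (proj₂ (nn a) eq))
                  λ a′ flipped → to-hamCloser a′ P N (proj₁ (nn a′) (trans flipped (cong not eq))))

open Nat using (_≤_)

-- n ≥ 1 provides the grid step 1/n of part (a).
proposition1 : ∀ (n : ℕ) → 1 ≤ n →
    (∀ (f : BoolFun n) → Symmetric f → NN≤ f (suc n)) ×
    BNN≡ (parity {n}) (2 ^ n)
proposition1 (suc m) _ = symmetric-nn m , parity-bnn-upper (suc m) , parity-bnn-lower (suc m)
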